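{- Let $y$ be an even integer and $x$ an odd integer with $y/2\le x<y-1$. Let $d$ be an even integer with $0\le d\le y-x-1$. Then for every integer $c\ge0$ there is a standard linear realization of $\{1^{y-1-d},x^d,y^c\}$. Consequently, for all integers $a,b,c\ge0$ with $a\ge 2x$ and $b\ge y-x-1$, the multiset $\{1^a,x^b,y^c\}$ has a linear realization.
   Context: For a positive integer $n$, $K_n$ is the complete graph on vertex set $\{0,\dots,n-1\}$ and the linear length of an edge $\{u,w\}$ is $|u-w|$. A multiset of positive integers of size $n-1$ has a linear realization if some Hamiltonian path in $K_n$ has multiset of linear edge lengths equal to it; it is standard if the path starts at $0$. $\{x_1^{a_1},\dots\}$ denotes the multiset with $x_i$ of multiplicity $a_i$. -}

module Defs where

open import Data.Nat using (ℕ; zero; suc; _∸_; _+_; _*_; ∣_-_∣)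
open import Data.List using (List; []; _∷_; length; upTo; replicate; _++_)
open import Data.List.Relation.Binary.Permutation.Propositional using (_↭_)
open import Data.Product using (Σ; _×_)
open import Relation.Binary.PropositionalEquality using (_≡_)

edgeLengths : List ℕ → List ℕ
edgeLengths []             = []
edgeLengths (u ∷ [])       = []
edgeLengths (u ∷ w ∷ rest) = ∣ u - w ∣ ∷ edgeLengths (w ∷ rest)

IsHamPath : ℕ → List ℕ → Set
IsHamPath n p = p ↭ upTo n

-- multisets are lists up to permutation.
-- L (of size n-1) has a linear realization: a Hamiltonian path in K_n, n = |L|+1,
-- whose multiset of linear edge lengths equals L
HasLinearRealization : List ℕ → Set
HasLinearRealization L =
  Σ (List ℕ) λ p → IsHamPath (suc (length L)) p × (edgeLengths p ↭ L)

HasStandardLinearRealization : List ℕ → Set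
HasStandardLinearRealization L =
  Σ (List ℕ) λ p → Σ (List ℕ) λ q → (p ≡ 0 ∷ q) × IsHamPath (suc (length L)) p × (edgeLengths p ↭ L)

msetXY : ℕ → ℕ → ℕ → ℕ → ℕ → List ℕ
msetXY a x b y c = replicate a 1 ++ replicate b x ++ replicate c y

{-# OPTIONS --safe #-}
-- Write x = 2β + 1, d = 2δ, y = 2(α + β + δ + 1) and c = q y + t with t < y.  The vertices
-- 0, …, c + y − 1 split into the y chains r, r + y, r + 2y, … (r < y), those with r < t
-- having one vertex more.  A walk that climbs one chain, crosses at the top to a neighbouring
-- chain of the same height, descends it and then moves on to the next pair of chains uses the
-- c edges of length y inside the chains, and its y − 1 junctions are the remaining edges.
-- Pairing the chains as (2i, 2i + 1) when t is even, or as (2j + 2, 2j + 1) after the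
-- wrap-around pair (0, y − 1) when t is odd, makes every top junction 1.  Visiting the pairs
-- in the order 0, 1, …, α, then alternately α + β + i and α + i for i = 1, …, δ, then
-- α + δ + 1, …, α + β makes exactly 2δ bottom junctions equal to x and all others 1: this
-- realizes {1^(y−1−2δ), x^(2δ), y^c}.  The same walks modulo x realize {1^x, x^m} (after a
-- first edge 0 → 1), except when m mod x is odd and at least 3, where one chain is split so
-- as to trade an edge x for an edge 1.  For the second claim, a realization of
-- {1^x, x^(y−x−1), y^c} is reflected and reversed, and followed by a shifted realization of
-- {1^(a−x), x^(b−y+x+1)}.
module Submission where

open import Defs
open import Data.Nat using (ℕ; zero; suc; _+_; _*_; _∸_; _≤_; _<_; ∣_-_∣; _<ᵇ_; z≤n; s≤s; s≤s⁻¹; _/_; _%_; NonZero)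
open import Data.Nat.Properties
open import Data.Nat.DivMod using (m≡m%n+[m/n]*n; m%n<n)
open import Data.Nat.Tactic.RingSolver using (solve-∀)
open import Data.Bool using (true; false; if_then_else_)
open import Data.List
  using (List; []; _∷_; _++_; [_]; _∷ʳ_; length; upTo; replicate; map; reverse; iterate; applyUpTo; applyDownFrom; concatMap)
import Data.List.Properties as List
open import Data.List.Relation.Unary.All as All using (All; []; _∷_)
import Data.List.Relation.Unary.All.Properties as All
open import Data.List.Relation.Binary.Permutation.Propositional
  using (_↭_; ↭-refl; ↭-sym; ↭-trans; ↭-reflexive; ↭-prep; ↭-swap; module PermutationReasoning)
open import Data.List.Relation.Binary.Permutation.Propositional.Properties
  using (++⁺; ++⁺ˡ; ++⁺ʳ; shifts; shift; map⁺; drop-∷; ∷↭∷ʳ; ↭-reverse; ↭-length; All-resp-↭; ++-comm; ++-commutativeMonoid)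
open import Data.Product using (_×_; _,_; ∃)
open import Data.Sum using (_⊎_; inj₁; inj₂)
open import Function using (_∘_)
open import Relation.Binary.PropositionalEquality hiding ([_])
open import Relation.Nullary using (contradiction)
open import Relation.Nullary.Reflects using (ofʸ; ofⁿ)

private
  variable
    A B : Set

replicate-+ : ∀ m n (x : A) → replicate (m + n) x ≡ replicate m x ++ replicate n x
replicate-+ zero    n x = refl
replicate-+ (suc m) n x = cong (x ∷_) (replicate-+ m n x)

concatMap⁺ : ∀ (f : A → List B) {xs ys} → xs ↭ ys → concatMap f xs ↭ concatMap f ys
concatMap⁺ f (_↭_.refl)          = ↭-refl
concatMap⁺ f (_↭_.prep x p)      = ++⁺ˡ (f x) (concatMap⁺ f p)
concatMap⁺ f (_↭_.swap x y p)    = ↭-trans (shifts (f x) (f y)) (++⁺ˡ (f y) (++⁺ˡ (f x) (concatMap⁺ f p)))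
concatMap⁺ f (_↭_.trans p₁ p₂)   = ↭-trans (concatMap⁺ f p₁) (concatMap⁺ f p₂)

concatMap-++-distrib : ∀ (f g : A → List B) xs →
  concatMap (λ x → f x ++ g x) xs ↭ concatMap f xs ++ concatMap g xs
concatMap-++-distrib f g []       = ↭-refl
concatMap-++-distrib f g (x ∷ xs) = begin
    (f x ++ g x) ++ concatMap (λ x → f x ++ g x) xs
  ≡⟨ List.++-assoc (f x) (g x) _ ⟩
    f x ++ g x ++ concatMap (λ x → f x ++ g x) xs
  ↭⟨ ++⁺ˡ (f x) (++⁺ˡ (g x) (concatMap-++-distrib f g xs)) ⟩
    f x ++ g x ++ concatMap f xs ++ concatMap g xs
  ↭⟨ ++⁺ˡ (f x) (shifts (g x) (concatMap f xs)) ⟩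
    f x ++ concatMap f xs ++ g x ++ concatMap g xs
  ≡⟨ List.++-assoc (f x) (concatMap f xs) _ ⟨
    (f x ++ concatMap f xs) ++ g x ++ concatMap g xs
  ∎
  where open PermutationReasoning

interval : ℕ → ℕ → List ℕ
interval = iterate suc

interval-++ : ∀ a k l → interval a (k + l) ≡ interval a k ++ interval (a + k) l
interval-++ a zero    l = cong (λ b → interval b l) (sym (+-identityʳ a))
interval-++ a (suc k) l =
  cong (a ∷_) (trans (interval-++ (suc a) k l) (cong (λ b → interval (suc a) k ++ interval b l) (sym (+-suc a k))))

interval-join : ∀ {a b} k l → a + k ≡ b → interval a k ++ interval b l ≡ interval a (k + l)
interval-join {a} k l refl = sym (interval-++ a k l)

interval-∷ʳ : ∀ a k → interval a (suc k) ≡ interval a k ∷ʳ (a + k)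
interval-∷ʳ a k = trans (cong (interval a) (+-comm 1 k)) (interval-++ a k 1)

map-interval : ∀ (f : ℕ → ℕ) a k → (∀ i → f (suc i) ≡ suc (f i)) → map f (interval a k) ≡ interval (f a) k
map-interval f a zero    f-suc = refl
map-interval f a (suc k) f-suc = cong (f a ∷_) (trans (map-interval f (suc a) k f-suc) (cong (λ b → interval b k) (f-suc a)))

upTo-interval : ∀ n → upTo n ≡ interval 0 n
upTo-interval n = go (λ i → i) n (λ _ → refl)
  where
  go : ∀ (f : ℕ → ℕ) n → (∀ i → f (suc i) ≡ suc (f i)) → applyUpTo f n ≡ interval (f 0) n
  go f zero    f-suc = refl
  go f (suc n) f-suc = cong (f 0 ∷_) (trans (go (f ∘ suc) n (f-suc ∘ suc)) (cong (λ b → interval b n) (f-suc 0)))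

interval-bounded : ∀ a k → All (_< a + k) (interval a k)
interval-bounded a zero    = []
interval-bounded a (suc k) =
  m<m+n a (s≤s z≤n) ∷ All.map (λ {i} i<1+a+k → subst (i <_) (sym (+-suc a k)) i<1+a+k) (interval-bounded (suc a) k)

map-∸-interval : ∀ n → map (n ∸_) (interval 0 (suc n)) ↭ interval 0 (suc n)
map-∸-interval zero    = ↭-refl
map-∸-interval (suc n) = begin
    suc n ∷ map (suc n ∸_) (interval 1 (suc n))
  ≡⟨ cong (λ is → suc n ∷ map (suc n ∸_) is) (sym (map-interval suc 0 (suc n) (λ _ → refl))) ⟩
    suc n ∷ map (suc n ∸_) (map suc (interval 0 (suc n)))
  ≡⟨ cong (suc n ∷_) (List.map-∘ (interval 0 (suc n))) ⟨
    suc n ∷ map (n ∸_) (interval 0 (suc n))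
  ↭⟨ ↭-prep (suc n) (map-∸-interval n) ⟩
    suc n ∷ interval 0 (suc n)
  ↭⟨ ∷↭∷ʳ (suc n) (interval 0 (suc n)) ⟩
    interval 0 (suc n) ∷ʳ suc n
  ≡⟨ interval-∷ʳ 0 (suc n) ⟨
    interval 0 (suc (suc n))
  ∎
  where open PermutationReasoning

edgesFrom : ℕ → List ℕ → List ℕ
edgesFrom u []       = []
edgesFrom u (w ∷ ws) = ∣ u - w ∣ ∷ edgesFrom w ws

lastFrom : ℕ → List ℕ → ℕ
lastFrom u []       = u
lastFrom u (w ∷ ws) = lastFrom w ws

edgeLengths-∷ : ∀ u ws → edgeLengths (u ∷ ws) ≡ edgesFrom u ws
edgeLengths-∷ u []       = refl
edgeLengths-∷ u (w ∷ ws) = cong (∣ u - w ∣ ∷_) (edgeLengths-∷ w ws)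

edgesFrom-++ : ∀ u xs ys → edgesFrom u (xs ++ ys) ≡ edgesFrom u xs ++ edgesFrom (lastFrom u xs) ys
edgesFrom-++ u []       ys = refl
edgesFrom-++ u (x ∷ xs) ys = cong (∣ u - x ∣ ∷_) (edgesFrom-++ x xs ys)

lastFrom-∷ʳ : ∀ v xs w → lastFrom v (xs ∷ʳ w) ≡ w
lastFrom-∷ʳ v []       w = refl
lastFrom-∷ʳ v (x ∷ xs) w = lastFrom-∷ʳ x xs w

edgeLengths-++-∷ : ∀ xs u ys → edgeLengths (xs ++ u ∷ ys) ≡ edgeLengths (xs ∷ʳ u) ++ edgesFrom u ys
edgeLengths-++-∷ []           u ys = edgeLengths-∷ u ys
edgeLengths-++-∷ (x ∷ [])     u ys = cong (∣ x - u ∣ ∷_) (edgeLengths-∷ u ys)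
edgeLengths-++-∷ (x ∷ y ∷ xs) u ys = cong (∣ x - y ∣ ∷_) (edgeLengths-++-∷ (y ∷ xs) u ys)

edgeLengths-reverse : ∀ u ws → edgeLengths (reverse (u ∷ ws)) ≡ reverse (edgesFrom u ws)
edgeLengths-reverse u []       = refl
edgeLengths-reverse u (w ∷ ws) = begin
    edgeLengths (reverse (u ∷ w ∷ ws))
  ≡⟨ cong edgeLengths (List.unfold-reverse u (w ∷ ws)) ⟩
    edgeLengths (reverse (w ∷ ws) ∷ʳ u)
  ≡⟨ cong (λ vs → edgeLengths (vs ∷ʳ u)) (List.unfold-reverse w ws) ⟩
    edgeLengths ((reverse ws ∷ʳ w) ∷ʳ u)
  ≡⟨ cong edgeLengths (List.++-assoc (reverse ws) [ w ] [ u ]) ⟩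
    edgeLengths (reverse ws ++ w ∷ [ u ])
  ≡⟨ edgeLengths-++-∷ (reverse ws) w [ u ] ⟩
    edgeLengths (reverse ws ∷ʳ w) ∷ʳ ∣ w - u ∣
  ≡⟨ cong₂ (λ vs d → edgeLengths vs ∷ʳ d) (List.unfold-reverse w ws) (∣-∣-comm u w) ⟨
    edgeLengths (reverse (w ∷ ws)) ∷ʳ ∣ u - w ∣
  ≡⟨ cong (_∷ʳ ∣ u - w ∣) (edgeLengths-reverse w ws) ⟩
    reverse (edgesFrom w ws) ∷ʳ ∣ u - w ∣
  ≡⟨ List.unfold-reverse ∣ u - w ∣ (edgesFrom w ws) ⟨
    reverse (edgesFrom u (w ∷ ws))
  ∎
  where open ≡-Reasoning

∣n-1+n∣≡1 : ∀ n → ∣ n - suc n ∣ ≡ 1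
∣n-1+n∣≡1 zero    = refl
∣n-1+n∣≡1 (suc n) = ∣n-1+n∣≡1 n

∣1+n-n∣≡1 : ∀ n → ∣ suc n - n ∣ ≡ 1
∣1+n-n∣≡1 n = trans (∣-∣-comm (suc n) n) (∣n-1+n∣≡1 n)

edgesFrom-shift : ∀ c u ws → edgesFrom (c + u) (map (c +_) ws) ≡ edgesFrom u ws
edgesFrom-shift c u []       = refl
edgesFrom-shift c u (w ∷ ws) = cong₂ _∷_ (∣m+n-m+o∣≡∣n-o∣ c u w) (edgesFrom-shift c w ws)

∣m+o-n+o∣≡∣m-n∣ : ∀ m n z → ∣ m + z - n + z ∣ ≡ ∣ m - n ∣
∣m+o-n+o∣≡∣m-n∣ m n z = trans (cong₂ ∣_-_∣ (+-comm m z) (+-comm n z)) (∣m+n-m+o∣≡∣n-o∣ z m n)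

∣o∸m-o∸n∣≡∣m-n∣ : ∀ {K u w} → u ≤ K → w ≤ K → ∣ K ∸ u - K ∸ w ∣ ≡ ∣ u - w ∣
∣o∸m-o∸n∣≡∣m-n∣ {K} {u} {w} u≤K w≤K = begin
    ∣ K ∸ u - K ∸ w ∣
  ≡⟨ ∣m+o-n+o∣≡∣m-n∣ (K ∸ u) (K ∸ w) (u + w) ⟨
    ∣ K ∸ u + (u + w) - K ∸ w + (u + w) ∣
  ≡⟨ cong₂ ∣_-_∣ (trans (sym (+-assoc (K ∸ u) u w)) (cong (_+ w) (m∸n+n≡m u≤K)))
                 (trans (cong (K ∸ w +_) (+-comm u w)) (trans (sym (+-assoc (K ∸ w) w u)) (cong (_+ u) (m∸n+n≡m w≤K)))) ⟩
    ∣ K + w - K + u ∣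
  ≡⟨ ∣m+n-m+o∣≡∣n-o∣ K w u ⟩
    ∣ w - u ∣
  ≡⟨ ∣-∣-comm w u ⟩
    ∣ u - w ∣
  ∎
  where open ≡-Reasoning

edgesFrom-reflect : ∀ K u ws → u ≤ K → All (_≤ K) ws → edgesFrom (K ∸ u) (map (K ∸_) ws) ≡ edgesFrom u ws
edgesFrom-reflect K u []       u≤K []            = refl
edgesFrom-reflect K u (w ∷ ws) u≤K (w≤K ∷ ws≤K) =
  cong₂ _∷_ (∣o∸m-o∸n∣≡∣m-n∣ u≤K w≤K) (edgesFrom-reflect K w ws w≤K ws≤K)

linear-resp-↭ : ∀ {L L′} → L ↭ L′ → HasLinearRealization L → HasLinearRealization L′
linear-resp-↭ L↭L′ (p , ham , edges) = p , subst (λ n → p ↭ upTo (suc n)) (↭-length L↭L′) ham , ↭-trans edges L↭L′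

standard-resp-↭ : ∀ {L L′} → L ↭ L′ → HasStandardLinearRealization L → HasStandardLinearRealization L′
standard-resp-↭ L↭L′ (p , q , p≡0∷q , ham , edges) =
  p , q , p≡0∷q , subst (λ n → p ↭ upTo (suc n)) (↭-length L↭L′) ham , ↭-trans edges L↭L′

standard-∷-1 : ∀ {L} → HasStandardLinearRealization L → HasStandardLinearRealization (1 ∷ L)
standard-∷-1 {L} (.(0 ∷ q) , q , refl , ham , edges) = 0 ∷ map suc (0 ∷ q) , _ , refl , ham′ , edges′
  where
  ham′ : 0 ∷ map suc (0 ∷ q) ↭ upTo (suc (suc (length L)))
  ham′ = ↭-prep 0 (↭-trans (map⁺ suc ham) (↭-reflexive (List.map-upTo suc (suc (length L)))))
  edges′ : edgeLengths (0 ∷ map suc (0 ∷ q)) ↭ 1 ∷ L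
  edges′ = ↭-prep 1 (↭-trans (↭-reflexive (trans (edgeLengths-∷ 1 (map suc q))
                                             (trans (edgesFrom-shift 1 0 q) (sym (edgeLengths-∷ 0 q)))))
                             edges)

standard-ones-++ : ∀ n {L} → HasStandardLinearRealization L → HasStandardLinearRealization (replicate n 1 ++ L)
standard-ones-++ zero    R = R
standard-ones-++ (suc n) R = standard-∷-1 (standard-ones-++ n R)

-- The first path is reflected (v ↦ K − v) and reversed to end at K, where the second,
-- shifted by K, continues.
linear-++ : ∀ {L₁ L₂} → HasStandardLinearRealization L₁ → HasStandardLinearRealization L₂ →
            HasLinearRealization (L₁ ++ L₂)
linear-++ {L₁} {L₂} (.(0 ∷ p) , p , refl , ham₁ , edges₁) (.(0 ∷ q) , q , refl , ham₂ , edges₂) =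
  reverse p′ ++ K ∷ q′ , ham , edges
  where
  K l : ℕ
  K = length L₁
  l = length L₂
  p′ q′ : List ℕ
  p′ = map (K ∸_) p
  q′ = map (K +_) q
  p↭ : 0 ∷ p ↭ interval 0 (suc K)
  p↭ = ↭-trans ham₁ (↭-reflexive (upTo-interval (suc K)))
  q↭ : q ↭ interval 1 l
  q↭ = drop-∷ (↭-trans ham₂ (↭-reflexive (upTo-interval (suc l))))
  p≤K : All (_≤ K) p
  p≤K with All-resp-↭ (↭-sym p↭) (interval-bounded 0 (suc K))
  ... | _ ∷ p<1+K = All.map ≤-pred p<1+K
  ham : reverse p′ ++ K ∷ q′ ↭ upTo (suc (length (L₁ ++ L₂)))
  ham = begin
      reverse p′ ++ K ∷ q′
    ↭⟨ shift K (reverse p′) q′ ⟩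
      K ∷ reverse p′ ++ q′
    ↭⟨ ↭-prep K (++⁺ʳ q′ (↭-reverse p′)) ⟩
      map (K ∸_) (0 ∷ p) ++ q′
    ↭⟨ ++⁺ (↭-trans (map⁺ (K ∸_) p↭) (map-∸-interval K)) (map⁺ (K +_) q↭) ⟩
      interval 0 (suc K) ++ map (K +_) (interval 1 l)
    ≡⟨ cong (interval 0 (suc K) ++_) (trans (map-interval (K +_) 1 l (+-suc K)) (cong (λ a → interval a l) (+-comm K 1))) ⟩
      interval 0 (suc K) ++ interval (suc K) l
    ≡⟨ interval-++ 0 (suc K) l ⟨
      interval 0 (suc K + l)
    ≡⟨ cong (λ n → interval 0 (suc n)) (List.length-++ L₁) ⟨
      interval 0 (suc (length (L₁ ++ L₂)))
    ≡⟨ upTo-interval _ ⟨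
      upTo (suc (length (L₁ ++ L₂)))
    ∎
    where open PermutationReasoning
  edges : edgeLengths (reverse p′ ++ K ∷ q′) ↭ L₁ ++ L₂
  edges = begin
      edgeLengths (reverse p′ ++ K ∷ q′)
    ≡⟨ edgeLengths-++-∷ (reverse p′) K q′ ⟩
      edgeLengths (reverse p′ ∷ʳ K) ++ edgesFrom K q′
    ≡⟨ cong (λ vs → edgeLengths vs ++ edgesFrom K q′) (List.unfold-reverse K p′) ⟨
      edgeLengths (reverse (K ∷ p′)) ++ edgesFrom K q′
    ≡⟨ cong₂ _++_ (edgeLengths-reverse K p′) (cong (λ u → edgesFrom u q′) (sym (+-identityʳ K))) ⟩
      reverse (edgesFrom (K ∸ 0) p′) ++ edgesFrom (K + 0) q′
    ≡⟨ cong₂ (λ es fs → reverse es ++ fs) (edgesFrom-reflect K 0 p z≤n p≤K) (edgesFrom-shift K 0 q) ⟩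
      reverse (edgesFrom 0 p) ++ edgesFrom 0 q
    ↭⟨ ++⁺ʳ (edgesFrom 0 q) (↭-reverse (edgesFrom 0 p)) ⟩
      edgesFrom 0 p ++ edgesFrom 0 q
    ≡⟨ cong₂ _++_ (edgeLengths-∷ 0 p) (edgeLengths-∷ 0 q) ⟨
      edgeLengths (0 ∷ p) ++ edgeLengths (0 ∷ q)
    ↭⟨ ++⁺ edges₁ edges₂ ⟩
      L₁ ++ L₂
    ∎
    where open PermutationReasoning

data Segment : Set where
  up down : ℕ → ℕ → Segment

base steps : Segment → ℕ
base (up a k)    = a
base (down a k)  = a
steps (up a k)   = k
steps (down a k) = k

totalSteps : List Segment → ℕ
totalSteps []       = 0
totalSteps (s ∷ ss) = steps s + totalSteps ss

module Walks (M : ℕ) where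

  progression : ℕ → ℕ → List ℕ
  progression a k = iterate (_+ M) a (suc k)

  progression-∷ʳ : ∀ a k → progression a (suc k) ≡ progression a k ∷ʳ (a + suc k * M)
  progression-∷ʳ a zero    = cong (λ b → a ∷ [ b ]) (cong (a +_) (sym (+-identityʳ M)))
  progression-∷ʳ a (suc k) =
    cong (a ∷_) (trans (progression-∷ʳ (a + M) k) (cong (progression (a + M) k ∷ʳ_) (+-assoc a M (suc k * M))))

  edgesFrom-progression : ∀ v a k → edgesFrom v (progression a k) ≡ ∣ v - a ∣ ∷ replicate k M
  edgesFrom-progression v a zero    = refl
  edgesFrom-progression v a (suc k) =
    cong (∣ v - a ∣ ∷_) (trans (edgesFrom-progression a (a + M) k) (cong (_∷ replicate k M) (∣m-m+n∣≡n a M)))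

  lastFrom-progression : ∀ v a k → lastFrom v (progression a k) ≡ a + k * M
  lastFrom-progression v a zero    = sym (+-identityʳ a)
  lastFrom-progression v a (suc k) = trans (lastFrom-progression a (a + M) k) (+-assoc a M (k * M))

  lastFrom-reverse-progression : ∀ v a k → lastFrom v (reverse (progression a k)) ≡ a
  lastFrom-reverse-progression v a k =
    trans (cong (lastFrom v) (List.unfold-reverse a (iterate (_+ M) (a + M) k))) (lastFrom-∷ʳ v (reverse (iterate (_+ M) (a + M) k)) a)

  edgesFrom-reverse-progression : ∀ v a k → edgesFrom v (reverse (progression a k)) ≡ ∣ v - a + k * M ∣ ∷ replicate k M
  edgesFrom-reverse-progression v a zero    = cong (λ b → ∣ v - b ∣ ∷ []) (sym (+-identityʳ a))
  edgesFrom-reverse-progression v a (suc k) = begin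
      edgesFrom v (reverse (a ∷ progression (a + M) k))
    ≡⟨ cong (edgesFrom v) (List.unfold-reverse a (progression (a + M) k)) ⟩
      edgesFrom v (reverse (progression (a + M) k) ∷ʳ a)
    ≡⟨ edgesFrom-++ v (reverse (progression (a + M) k)) [ a ] ⟩
      edgesFrom v (reverse (progression (a + M) k)) ++ [ ∣ lastFrom v (reverse (progression (a + M) k)) - a ∣ ]
    ≡⟨ cong₂ (λ es u → es ++ [ ∣ u - a ∣ ])
             (edgesFrom-reverse-progression v (a + M) k) (lastFrom-reverse-progression v (a + M) k) ⟩
      ∣ v - a + M + k * M ∣ ∷ replicate k M ++ [ ∣ a + M - a ∣ ]
    ≡⟨ cong₂ (λ b d → ∣ v - b ∣ ∷ replicate k M ++ [ d ])
             (+-assoc a M (k * M)) (trans (∣-∣-comm (a + M) a) (∣m-m+n∣≡n a M)) ⟩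
      ∣ v - a + suc k * M ∣ ∷ replicate k M ++ replicate 1 M
    ≡⟨ cong (∣ v - a + suc k * M ∣ ∷_) (trans (sym (replicate-+ k 1 M)) (cong (λ n → replicate n M) (+-comm k 1))) ⟩
      ∣ v - a + suc k * M ∣ ∷ replicate (suc k) M
    ∎
    where open ≡-Reasoning

  vertices : Segment → List ℕ
  vertices (up a k)   = progression a k
  vertices (down a k) = reverse (progression a k)

  entry exit : Segment → ℕ
  entry (up a k)   = a
  entry (down a k) = a + k * M
  exit (up a k)     = a + k * M
  exit (down a k)   = a

  edgesFrom-vertices : ∀ v s → edgesFrom v (vertices s) ≡ ∣ v - entry s ∣ ∷ replicate (steps s) M
  edgesFrom-vertices v (up a k)   = edgesFrom-progression v a k
  edgesFrom-vertices v (down a k) = edgesFrom-reverse-progression v a k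

  lastFrom-vertices : ∀ v s → lastFrom v (vertices s) ≡ exit s
  lastFrom-vertices v (up a k)   = lastFrom-progression v a k
  lastFrom-vertices v (down a k) = lastFrom-reverse-progression v a k

  vertices↭progression : ∀ s → vertices s ↭ progression (base s) (steps s)
  vertices↭progression (up a k)   = ↭-refl
  vertices↭progression (down a k) = ↭-reverse (progression a k)

  walk : List Segment → List ℕ
  walk = concatMap vertices

  junctionsFrom : ℕ → List Segment → List ℕ
  junctionsFrom v []       = []
  junctionsFrom v (s ∷ ss) = ∣ v - entry s ∣ ∷ junctionsFrom (exit s) ss

  edgesFrom-walk : ∀ v ss → edgesFrom v (walk ss) ↭ junctionsFrom v ss ++ replicate (totalSteps ss) M
  edgesFrom-walk v []       = ↭-refl
  edgesFrom-walk v (s ∷ ss) = begin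
      edgesFrom v (vertices s ++ walk ss)
    ≡⟨ edgesFrom-++ v (vertices s) (walk ss) ⟩
      edgesFrom v (vertices s) ++ edgesFrom (lastFrom v (vertices s)) (walk ss)
    ≡⟨ cong₂ (λ es u → es ++ edgesFrom u (walk ss)) (edgesFrom-vertices v s) (lastFrom-vertices v s) ⟩
      ∣ v - entry s ∣ ∷ replicate (steps s) M ++ edgesFrom (exit s) (walk ss)
    ↭⟨ ↭-prep _ (++⁺ˡ (replicate (steps s) M) (edgesFrom-walk (exit s) ss)) ⟩
      ∣ v - entry s ∣ ∷ replicate (steps s) M ++ junctionsFrom (exit s) ss ++ replicate (totalSteps ss) M
    ↭⟨ ↭-prep _ (shifts (replicate (steps s) M) (junctionsFrom (exit s) ss)) ⟩
      ∣ v - entry s ∣ ∷ junctionsFrom (exit s) ss ++ replicate (steps s) M ++ replicate (totalSteps ss) M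
    ≡⟨ cong (λ ms → ∣ v - entry s ∣ ∷ junctionsFrom (exit s) ss ++ ms) (replicate-+ (steps s) (totalSteps ss) M) ⟨
      junctionsFrom v (s ∷ ss) ++ replicate (totalSteps (s ∷ ss)) M
    ∎
    where open PermutationReasoning

  length-walk : ∀ ss → length (walk ss) ≡ totalSteps ss + length ss
  length-walk []       = refl
  length-walk (s ∷ ss) = begin
      length (vertices s ++ walk ss)
    ≡⟨ List.length-++ (vertices s) ⟩
      length (vertices s) + length (walk ss)
    ≡⟨ cong₂ _+_ (trans (↭-length (vertices↭progression s)) (List.length-iterate (_+ M) (base s) (suc (steps s))))
                 (length-walk ss) ⟩
      suc (steps s) + (totalSteps ss + length ss)
    ≡⟨ cong suc (+-assoc (steps s) (totalSteps ss) (length ss)) ⟨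
      suc (steps s + totalSteps ss + length ss)
    ≡⟨ +-suc (steps s + totalSteps ss) (length ss) ⟨
      totalSteps (s ∷ ss) + length (s ∷ ss)
    ∎
    where open ≡-Reasoning

  length-junctionsFrom : ∀ v ss → length (junctionsFrom v ss) ≡ length ss
  length-junctionsFrom v []       = refl
  length-junctionsFrom v (s ∷ ss) = cong suc (length-junctionsFrom (exit s) ss)

  totalSteps-cover : ∀ {N} ss → walk ss ↭ interval 0 N → totalSteps ss + length ss ≡ N
  totalSteps-cover {N} ss cover = trans (sym (length-walk ss)) (trans (↭-length cover) (List.length-iterate suc 0 N))

  -- The first junction is the dummy ∣ 0 - 0 ∣ = 0.
  walk-standard : ∀ {N} k ss J → walk (up 0 k ∷ ss) ↭ interval 0 N → junctionsFrom 0 (up 0 k ∷ ss) ↭ 0 ∷ J →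
                  HasStandardLinearRealization (J ++ replicate (totalSteps (up 0 k ∷ ss)) M)
  walk-standard {N} k ss J cover junctions = walk (up 0 k ∷ ss) , _ , refl , hamiltonian , edges
    where
    S : ℕ
    S = totalSteps (up 0 k ∷ ss)
    rest : List ℕ
    rest = iterate (_+ M) M k ++ walk ss
    size : N ≡ suc (length (J ++ replicate S M))
    size = begin
        N
      ≡⟨ totalSteps-cover (up 0 k ∷ ss) cover ⟨
        S + length (up 0 k ∷ ss)
      ≡⟨ cong (S +_) (trans (sym (length-junctionsFrom 0 (up 0 k ∷ ss))) (↭-length junctions)) ⟩
        S + suc (length J)
      ≡⟨ trans (+-suc S (length J)) (cong suc (+-comm S (length J))) ⟩
        suc (length J + S)
      ≡⟨ cong suc (trans (List.length-++ J) (cong (length J +_) (List.length-replicate S))) ⟨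
        suc (length (J ++ replicate S M))
      ∎
      where open ≡-Reasoning
    hamiltonian : walk (up 0 k ∷ ss) ↭ upTo (suc (length (J ++ replicate S M)))
    hamiltonian = ↭-trans cover (↭-reflexive (trans (cong (interval 0) size) (sym (upTo-interval _))))
    edges : edgeLengths (0 ∷ rest) ↭ J ++ replicate S M
    edges = drop-∷ (begin
        0 ∷ edgeLengths (0 ∷ rest)
      ≡⟨ cong (0 ∷_) (edgeLengths-∷ 0 rest) ⟩
        edgesFrom 0 (walk (up 0 k ∷ ss))
      ↭⟨ edgesFrom-walk 0 (up 0 k ∷ ss) ⟩
        junctionsFrom 0 (up 0 k ∷ ss) ++ replicate S M
      ↭⟨ ++⁺ʳ (replicate S M) junctions ⟩
        0 ∷ J ++ replicate S M
      ∎)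
      where open PermutationReasoning

residues : List (ℕ × ℕ) → List ℕ
residues []             = []
residues ((u , w) ∷ ps) = u ∷ w ∷ residues ps

bottomGaps : ℕ → List (ℕ × ℕ) → List ℕ
bottomGaps v []             = []
bottomGaps v ((u , w) ∷ ps) = ∣ v - u ∣ ∷ bottomGaps w ps

lastResidue : ℕ → List (ℕ × ℕ) → ℕ
lastResidue v []             = v
lastResidue v ((u , w) ∷ ps) = lastResidue w ps

steps-cancel : ∀ T s R l r M c → T + (R + l) ≡ M + c → R + r ≡ M → s + l ≡ c + r → T ≡ s
steps-cancel T s R l r M c walk-length residue-count step-count = +-cancelʳ-≡ (R + l + r) T s (begin
    T + (R + l + r)      ≡⟨ +-assoc T (R + l) r ⟨
    T + (R + l) + r      ≡⟨ cong (_+ r) walk-length ⟩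
    M + c + r            ≡⟨ cong (λ m → m + c + r) residue-count ⟨
    R + r + c + r        ≡⟨ shuffle₁ R r c ⟩
    c + r + (R + r)      ≡⟨ cong (_+ (R + r)) step-count ⟨
    s + l + (R + r)      ≡⟨ shuffle₂ s l R r ⟩
    s + (R + l + r)      ∎)
  where
  open ≡-Reasoning
  shuffle₁ : ∀ R r c → R + r + c + r ≡ c + r + (R + r)
  shuffle₁ = solve-∀
  shuffle₂ : ∀ s l R r → s + l + (R + r) ≡ s + (R + l + r)
  shuffle₂ = solve-∀

module Chains (M q t : ℕ) where
  open Walks M

  height : ℕ → ℕ
  height r = if r <ᵇ t then suc q else q

  top : ℕ → ℕ
  top r = r + height r * M

  chain : ℕ → List ℕ
  chain r = progression r (height r)

  ascend descend : ℕ → Segment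
  ascend r  = up r (height r)
  descend r = down r (height r)

  height-< : ∀ {r} → r < t → height r ≡ suc q
  height-< {r} r<t with r <ᵇ t | <ᵇ-reflects-< r t
  ... | true  | _        = refl
  ... | false | ofⁿ r≮t = contradiction r<t r≮t

  height-≥ : ∀ {r} → t ≤ r → height r ≡ q
  height-≥ {r} t≤r with r <ᵇ t | <ᵇ-reflects-< r t
  ... | true  | ofʸ r<t = contradiction t≤r (<⇒≱ r<t)
  ... | false | _       = refl

  private
    extra : ℕ → List ℕ
    extra r = if r <ᵇ t then [ r + suc q * M ] else []

    chain-split : ∀ r → chain r ≡ progression r q ++ extra r
    chain-split r with r <ᵇ t
    ... | true  = progression-∷ʳ r q
    ... | false = sym (List.++-identityʳ (progression r q))

    concatMap-[-] : ∀ (f : ℕ → ℕ) xs → concatMap (λ x → [ f x ]) xs ≡ map f xs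
    concatMap-[-] f xs = trans (sym (List.concatMap-map [_] f xs)) (List.concatMap-pure (map f xs))

    rows : ∀ k → concatMap (λ r → progression r k) (interval 0 M) ↭ interval 0 (suc k * M)
    rows zero    = ↭-reflexive (trans (List.concatMap-pure (interval 0 M)) (cong (interval 0) (sym (+-identityʳ M))))
    rows (suc k) = begin
        concatMap (λ r → progression r (suc k)) (interval 0 M)
      ≡⟨ List.concatMap-cong (λ r → progression-∷ʳ r k) (interval 0 M) ⟩
        concatMap (λ r → progression r k ++ [ r + suc k * M ]) (interval 0 M)
      ↭⟨ concatMap-++-distrib (λ r → progression r k) (λ r → [ r + suc k * M ]) (interval 0 M) ⟩
        concatMap (λ r → progression r k) (interval 0 M) ++ concatMap (λ r → [ r + suc k * M ]) (interval 0 M)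
      ↭⟨ ++⁺ (rows k) (↭-reflexive (trans (concatMap-[-] (_+ suc k * M) (interval 0 M))
                                          (map-interval (_+ suc k * M) 0 M (λ _ → refl)))) ⟩
        interval 0 (suc k * M) ++ interval (suc k * M) M
      ≡⟨ interval-++ 0 (suc k * M) M ⟨
        interval 0 (suc k * M + M)
      ≡⟨ cong (interval 0) (+-comm (suc k * M) M) ⟩
        interval 0 (suc (suc k) * M)
      ∎
      where open PermutationReasoning

    extra-below : ∀ a n → a + n ≤ t → concatMap extra (interval a n) ≡ interval (a + suc q * M) n
    extra-below a zero    _       = refl
    extra-below a (suc n) a+1+n≤t with a <ᵇ t | <ᵇ-reflects-< a t
    ... | true  | _        = cong (a + suc q * M ∷_) (extra-below (suc a) n (subst (_≤ t) (+-suc a n) a+1+n≤t))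
    ... | false | ofⁿ a≮t = contradiction (≤-trans (s≤s (m≤m+n a n)) (subst (_≤ t) (+-suc a n) a+1+n≤t)) a≮t

    extra-above : ∀ a n → t ≤ a → concatMap extra (interval a n) ≡ []
    extra-above a zero    _   = refl
    extra-above a (suc n) t≤a with a <ᵇ t | <ᵇ-reflects-< a t
    ... | true  | ofʸ a<t = contradiction t≤a (<⇒≱ a<t)
    ... | false | _       = extra-above (suc a) n (m≤n⇒m≤1+n t≤a)

    extras : t ≤ M → concatMap extra (interval 0 M) ≡ interval (suc q * M) t
    extras t≤M = begin
        concatMap extra (interval 0 M)
      ≡⟨ cong (concatMap extra) (trans (cong (interval 0) (sym (m+[n∸m]≡n t≤M))) (interval-++ 0 t (M ∸ t))) ⟩
        concatMap extra (interval 0 t ++ interval t (M ∸ t))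
      ≡⟨ List.concatMap-++ extra (interval 0 t) (interval t (M ∸ t)) ⟩
        concatMap extra (interval 0 t) ++ concatMap extra (interval t (M ∸ t))
      ≡⟨ cong₂ _++_ (extra-below 0 t ≤-refl) (extra-above t (M ∸ t) ≤-refl) ⟩
        interval (suc q * M) t ++ []
      ≡⟨ List.++-identityʳ _ ⟩
        interval (suc q * M) t
      ∎
      where open ≡-Reasoning

  chains-cover : t ≤ M → concatMap chain (interval 0 M) ↭ interval 0 (suc q * M + t)
  chains-cover t≤M = begin
      concatMap chain (interval 0 M)
    ≡⟨ List.concatMap-cong chain-split (interval 0 M) ⟩
      concatMap (λ r → progression r q ++ extra r) (interval 0 M)
    ↭⟨ concatMap-++-distrib (λ r → progression r q) extra (interval 0 M) ⟩
      concatMap (λ r → progression r q) (interval 0 M) ++ concatMap extra (interval 0 M)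
    ↭⟨ ++⁺ (rows q) (↭-reflexive (extras t≤M)) ⟩
      interval 0 (suc q * M) ++ interval (suc q * M) t
    ≡⟨ interval-++ 0 (suc q * M) t ⟨
      interval 0 (suc q * M + t)
    ∎
    where open PermutationReasoning

  height-suc : ∀ r → suc r ≢ t → height (suc r) ≡ height r
  height-suc r 1+r≢t with suc r <ᵇ t | <ᵇ-reflects-< (suc r) t
  ... | true  | ofʸ 1+r<t = sym (height-< (<⇒≤ 1+r<t))
  ... | false | ofⁿ 1+r≮t = sym (height-≥ (≤-pred (≤∧≢⇒< (≮⇒≥ 1+r≮t) (≢-sym 1+r≢t))))

  Level : ℕ × ℕ → Set
  Level (u , w) = ∣ top u - top w ∣ ≡ 1

  level-up : ∀ r → suc r ≢ t → Level (r , suc r)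
  level-up r 1+r≢t = trans (cong (λ h → ∣ top r - suc r + h * M ∣) (height-suc r 1+r≢t)) (∣n-1+n∣≡1 (top r))

  level-down : ∀ r → suc r ≢ t → Level (suc r , r)
  level-down r 1+r≢t = trans (∣-∣-comm (top (suc r)) (top r)) (level-up r 1+r≢t)

  level-wrap : ∀ K → M ≡ suc K → 0 < t → t ≤ K → Level (0 , K)
  level-wrap K M≡1+K 0<t t≤K = begin
      ∣ height 0 * M - K + height K * M ∣
    ≡⟨ cong₂ (λ h h′ → ∣ h * M - K + h′ * M ∣) (height-< 0<t) (height-≥ t≤K) ⟩
      ∣ M + q * M - K + q * M ∣
    ≡⟨ cong (λ m → ∣ m + q * M - K + q * M ∣) M≡1+K ⟩
      ∣ suc (K + q * M) - K + q * M ∣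
    ≡⟨ ∣1+n-n∣≡1 (K + q * M) ⟩
      1
    ∎
    where open ≡-Reasoning

  pairWalk : List (ℕ × ℕ) → List Segment
  pairWalk []             = []
  pairWalk ((u , w) ∷ ps) = ascend u ∷ descend w ∷ pairWalk ps

  junctionsFrom-pairWalk : ∀ v ps ss → All Level ps →
    junctionsFrom v (pairWalk ps ++ ss) ↭ bottomGaps v ps ++ replicate (length ps) 1 ++ junctionsFrom (lastResidue v ps) ss
  junctionsFrom-pairWalk v []             ss []               = ↭-refl
  junctionsFrom-pairWalk v ((u , w) ∷ ps) ss (level ∷ levels) = begin
      ∣ v - u ∣ ∷ ∣ top u - top w ∣ ∷ junctionsFrom w (pairWalk ps ++ ss)
    ≡⟨ cong (λ d → ∣ v - u ∣ ∷ d ∷ junctionsFrom w (pairWalk ps ++ ss)) level ⟩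
      ∣ v - u ∣ ∷ 1 ∷ junctionsFrom w (pairWalk ps ++ ss)
    ↭⟨ ↭-prep _ (↭-prep 1 (junctionsFrom-pairWalk w ps ss levels)) ⟩
      ∣ v - u ∣ ∷ 1 ∷ bottomGaps w ps ++ replicate (length ps) 1 ++ rest
    ↭⟨ ↭-prep _ (↭-sym (shift 1 (bottomGaps w ps) (replicate (length ps) 1 ++ rest))) ⟩
      ∣ v - u ∣ ∷ bottomGaps w ps ++ 1 ∷ replicate (length ps) 1 ++ rest
    ∎
    where
    open PermutationReasoning
    rest : List ℕ
    rest = junctionsFrom (lastResidue w ps) ss

  pairWalk-vertices : ∀ ps → walk (pairWalk ps) ↭ concatMap chain (residues ps)
  pairWalk-vertices []             = ↭-refl
  pairWalk-vertices ((u , w) ∷ ps) = ++⁺ˡ (chain u) (++⁺ (↭-reverse (chain w)) (pairWalk-vertices ps))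

  length-pairWalk : ∀ ps → length (pairWalk ps) ≡ length (residues ps)
  length-pairWalk []             = refl
  length-pairWalk ((u , w) ∷ ps) = cong (suc ∘ suc) (length-pairWalk ps)

  pairWalk-cover : t ≤ M → ∀ ps ss rs → walk ss ↭ concatMap chain rs → residues ps ++ rs ↭ interval 0 M →
                   walk (pairWalk ps ++ ss) ↭ interval 0 (suc q * M + t)
  pairWalk-cover t≤M ps ss rs ss-cover residues-cover = begin
      walk (pairWalk ps ++ ss)
    ≡⟨ List.concatMap-++ vertices (pairWalk ps) ss ⟩
      walk (pairWalk ps) ++ walk ss
    ↭⟨ ++⁺ (pairWalk-vertices ps) ss-cover ⟩
      concatMap chain (residues ps) ++ concatMap chain rs
    ≡⟨ List.concatMap-++ chain (residues ps) rs ⟨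
      concatMap chain (residues ps ++ rs)
    ↭⟨ concatMap⁺ chain residues-cover ⟩
      concatMap chain (interval 0 M)
    ↭⟨ chains-cover t≤M ⟩
      interval 0 (suc q * M + t)
    ∎
    where open PermutationReasoning

  -- The count of edges of length M comes from each segment having one vertex more than steps.
  pairWalk-standard : t ≤ M → ∀ w ps ss rs {J} s →
    All Level ((0 , w) ∷ ps) →
    walk ss ↭ concatMap chain rs →
    residues ((0 , w) ∷ ps) ++ rs ↭ interval 0 M →
    bottomGaps w ps ++ replicate (suc (length ps)) 1 ++ junctionsFrom (lastResidue w ps) ss ↭ J →
    s + length ss ≡ q * M + t + length rs →
    HasStandardLinearRealization (J ++ replicate s M)
  pairWalk-standard t≤M w ps ss rs {J} s levels ss-cover residues-cover gaps count =
    standard-resp-↭ (↭-reflexive (cong (λ n → J ++ replicate n M) steps≡s))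
                    (walk-standard (height 0) tail J cover
                                   (↭-trans (junctionsFrom-pairWalk 0 ((0 , w) ∷ ps) ss levels) (↭-prep 0 gaps)))
    where
    tail : List Segment
    tail = descend w ∷ pairWalk ps ++ ss
    cover : walk (ascend 0 ∷ tail) ↭ interval 0 (suc q * M + t)
    cover = pairWalk-cover t≤M ((0 , w) ∷ ps) ss rs ss-cover residues-cover
    R : ℕ
    R = length (residues ((0 , w) ∷ ps))
    segments : length (ascend 0 ∷ tail) ≡ R + length ss
    segments = trans (List.length-++ (pairWalk ((0 , w) ∷ ps))) (cong (_+ length ss) (length-pairWalk ((0 , w) ∷ ps)))
    residues-count : R + length rs ≡ M
    residues-count = trans (sym (List.length-++ (residues ((0 , w) ∷ ps))))
                           (trans (↭-length residues-cover) (List.length-iterate suc 0 M))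
    steps≡s : totalSteps (ascend 0 ∷ tail) ≡ s
    steps≡s = steps-cancel (totalSteps (ascend 0 ∷ tail)) s R (length ss) (length rs) M (q * M + t)
                (trans (cong (totalSteps (ascend 0 ∷ tail) +_) (sym segments))
                       (trans (totalSteps-cover (ascend 0 ∷ tail) cover) (+-assoc M (q * M) t)))
                residues-count count

upPair downPair shiftedDownPair : ℕ → ℕ × ℕ
upPair i          = 2 * i , suc (2 * i)
downPair j        = suc (2 * j) , 2 * j
shiftedDownPair j = 2 + 2 * j , suc (2 * j)

residues-map-↭ : ∀ (f : ℕ → ℕ × ℕ) {is js} → is ↭ js → residues (map f is) ↭ residues (map f js)
residues-map-↭ f {is} {js} is↭js =
  ↭-trans (↭-reflexive (residues-map is)) (↭-trans (concatMap⁺ (pair ∘ f) is↭js) (↭-reflexive (sym (residues-map js))))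
  where
  pair : ℕ × ℕ → List ℕ
  pair (u , w) = u ∷ w ∷ []
  residues-map : ∀ is → residues (map f is) ≡ concatMap (pair ∘ f) is
  residues-map []       = refl
  residues-map (i ∷ is) = cong (pair (f i) ++_) (residues-map is)

bottomGaps-++ : ∀ v ps ps′ → bottomGaps v (ps ++ ps′) ≡ bottomGaps v ps ++ bottomGaps (lastResidue v ps) ps′
bottomGaps-++ v []             ps′ = refl
bottomGaps-++ v ((u , w) ∷ ps) ps′ = cong (∣ v - u ∣ ∷_) (bottomGaps-++ w ps ps′)

bottomGaps-upRun : ∀ p k → bottomGaps (suc (2 * p)) (map upPair (interval (suc p) k)) ≡ replicate k 1
bottomGaps-upRun p zero    = refl
bottomGaps-upRun p (suc k) =
  cong₂ _∷_ (trans (cong (λ n → ∣ suc (2 * p) - n ∣) (*-suc 2 p)) (∣n-1+n∣≡1 (suc (2 * p)))) (bottomGaps-upRun (suc p) k)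

lastResidue-upRun : ∀ p k → lastResidue (suc (2 * p)) (map upPair (interval (suc p) k)) ≡ suc (2 * (p + k))
lastResidue-upRun p zero    = cong (λ n → suc (2 * n)) (sym (+-identityʳ p))
lastResidue-upRun p (suc k) = trans (lastResidue-upRun (suc p) k) (cong (λ n → suc (2 * n)) (sym (+-suc p k)))

residues-upRun : ∀ a k → residues (map upPair (interval a k)) ≡ interval (2 * a) (2 * k)
residues-upRun a zero    = refl
residues-upRun a (suc k) =
  trans (cong (λ is → 2 * a ∷ suc (2 * a) ∷ is) (trans (residues-upRun (suc a) k) (cong (λ b → interval b (2 * k)) (*-suc 2 a))))
        (cong (interval (2 * a)) (sym (*-suc 2 k)))

residues-shiftedDownRun : ∀ a k → residues (map shiftedDownPair (interval a k)) ↭ interval (suc (2 * a)) (2 * k)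
residues-shiftedDownRun a zero    = ↭-refl
residues-shiftedDownRun a (suc k) = begin
    2 + 2 * a ∷ suc (2 * a) ∷ residues (map shiftedDownPair (interval (suc a) k))
  ↭⟨ ↭-swap _ _ (residues-shiftedDownRun (suc a) k) ⟩
    suc (2 * a) ∷ 2 + 2 * a ∷ interval (suc (2 * suc a)) (2 * k)
  ≡⟨ cong (λ b → suc (2 * a) ∷ 2 + 2 * a ∷ interval (suc b) (2 * k)) (*-suc 2 a) ⟩
    interval (suc (2 * a)) (2 + 2 * k)
  ≡⟨ cong (interval (suc (2 * a))) (*-suc 2 k) ⟨
    interval (suc (2 * a)) (2 * suc k)
  ∎
  where open PermutationReasoning

bottomGaps-downRun : ∀ lo k → bottomGaps (2 * (lo + k)) (map downPair (applyDownFrom (lo +_) k)) ≡ replicate k 1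
bottomGaps-downRun lo zero    = refl
bottomGaps-downRun lo (suc k) =
  cong₂ _∷_ (trans (cong (λ n → ∣ n - suc (2 * (lo + k)) ∣) (trans (cong (2 *_) (+-suc lo k)) (*-suc 2 (lo + k))))
                   (∣1+n-n∣≡1 (suc (2 * (lo + k)))))
            (bottomGaps-downRun lo k)

lastResidue-downRun : ∀ lo k → lastResidue (2 * (lo + k)) (map downPair (applyDownFrom (lo +_) k)) ≡ 2 * lo
lastResidue-downRun lo zero    = cong (2 *_) (+-identityʳ lo)
lastResidue-downRun lo (suc k) = lastResidue-downRun lo k

residues-downRun : ∀ lo k → residues (map downPair (applyDownFrom (lo +_) k)) ↭ interval (2 * lo) (2 * k)
residues-downRun lo zero    = ↭-refl
residues-downRun lo (suc k) = begin
    suc (2 * (lo + k)) ∷ 2 * (lo + k) ∷ residues (map downPair (applyDownFrom (lo +_) k))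
  ↭⟨ ↭-swap _ _ (residues-downRun lo k) ⟩
    (2 * (lo + k) ∷ suc (2 * (lo + k)) ∷ []) ++ interval (2 * lo) (2 * k)
  ↭⟨ ++-comm (2 * (lo + k) ∷ suc (2 * (lo + k)) ∷ []) (interval (2 * lo) (2 * k)) ⟩
    interval (2 * lo) (2 * k) ++ interval (2 * (lo + k)) 2
  ≡⟨ cong (λ b → interval (2 * lo) (2 * k) ++ interval b 2) (*-distribˡ-+ 2 lo k) ⟩
    interval (2 * lo) (2 * k) ++ interval (2 * lo + 2 * k) 2
  ≡⟨ interval-++ (2 * lo) (2 * k) 2 ⟨
    interval (2 * lo) (2 * k + 2)
  ≡⟨ cong (interval (2 * lo)) (trans (+-comm (2 * k) 2) (sym (*-suc 2 k))) ⟩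
    interval (2 * lo) (2 * suc k)
  ∎
  where open PermutationReasoning

even⊎odd : ∀ n → ∃ λ k → n ≡ 2 * k ⊎ n ≡ suc (2 * k)
even⊎odd zero    = 0 , inj₁ refl
even⊎odd (suc n) with even⊎odd n
... | k , inj₁ n≡2k   = k , inj₂ (cong suc n≡2k)
... | k , inj₂ n≡1+2k = suc k , inj₁ (trans (cong suc n≡1+2k) (sym (*-suc 2 k)))

divMod-elim : ∀ M .{{_ : NonZero M}} (P : ℕ → Set) → (∀ q t → t < M → P (q * M + t)) → ∀ c → P c
divMod-elim M P P-qM+t c =
  subst P (sym (trans (m≡m%n+[m/n]*n c M) (+-comm (c % M) (c / M * M)))) (P-qM+t (c / M) (c % M) (m%n<n c M))

zigzag : ℕ → ℕ → ℕ → List ℕ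
zigzag zero    u b = []
zigzag (suc k) u b = u ∷ b ∷ zigzag k (suc u) (suc b)

zigzag↭ : ∀ k u b → zigzag k u b ↭ interval b k ++ interval u k
zigzag↭ zero    u b = ↭-refl
zigzag↭ (suc k) u b =
  ↭-trans (↭-swap u b (zigzag↭ k (suc u) (suc b))) (↭-prep b (↭-sym (shift u (interval (suc b) k) (interval (suc u) k))))

bottomGaps-zigzag : ∀ β p k →
  bottomGaps (suc (2 * p)) (map upPair (zigzag k (suc (p + β)) (suc p))) ≡ replicate (2 * k) (suc (2 * β))
bottomGaps-zigzag β p zero    = refl
bottomGaps-zigzag β p (suc k) = begin
    ∣ suc (2 * p) - 2 * suc (p + β) ∣ ∷ ∣ suc (2 * suc (p + β)) - 2 * suc p ∣ ∷ bottomGaps (suc (2 * suc p)) rest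
  ≡⟨ cong₂ (λ d d′ → d ∷ d′ ∷ bottomGaps (suc (2 * suc p)) rest)
           (trans (cong (λ n → ∣ suc (2 * p) - n ∣) (across p β)) (∣m-m+n∣≡n (suc (2 * p)) (suc (2 * β))))
           (trans (cong (λ n → ∣ n - 2 * suc p ∣) (back p β))
                  (trans (∣-∣-comm (2 * suc p + suc (2 * β)) (2 * suc p)) (∣m-m+n∣≡n (2 * suc p) (suc (2 * β))))) ⟩
    suc (2 * β) ∷ suc (2 * β) ∷ bottomGaps (suc (2 * suc p)) rest
  ≡⟨ cong (λ gs → suc (2 * β) ∷ suc (2 * β) ∷ gs) (bottomGaps-zigzag β (suc p) k) ⟩
    replicate (2 + 2 * k) (suc (2 * β))
  ≡⟨ cong (λ n → replicate n (suc (2 * β))) (*-suc 2 k) ⟨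
    replicate (2 * suc k) (suc (2 * β))
  ∎
  where
  open ≡-Reasoning
  rest : List (ℕ × ℕ)
  rest = map upPair (zigzag k (suc (suc (p + β))) (suc (suc p)))
  across : ∀ p β → 2 * suc (p + β) ≡ suc (2 * p) + suc (2 * β)
  across = solve-∀
  back : ∀ p β → suc (2 * suc (p + β)) ≡ 2 * suc p + suc (2 * β)
  back = solve-∀

lastResidue-zigzag : ∀ β p k → lastResidue (suc (2 * p)) (map upPair (zigzag k (suc (p + β)) (suc p))) ≡ suc (2 * (p + k))
lastResidue-zigzag β p zero    = cong (λ n → suc (2 * n)) (sym (+-identityʳ p))
lastResidue-zigzag β p (suc k) = trans (lastResidue-zigzag β (suc p) k) (cong (λ n → suc (2 * n)) (sym (+-suc p k)))

∣odd-even∣-reflect : ∀ {K i i′} → i ≤ K → i′ ≤ K →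
  ∣ suc (2 * (K ∸ i)) - 2 + 2 * (K ∸ i′) ∣ ≡ ∣ suc (2 * i) - 2 * i′ ∣
∣odd-even∣-reflect {K} {i} {i′} i≤K i′≤K = begin
    ∣ suc (2 * a) - 2 + 2 * b ∣
  ≡⟨ ∣m+o-n+o∣≡∣m-n∣ (suc (2 * a)) (2 + 2 * b) (2 * i + 2 * i′) ⟨
    ∣ suc (2 * a) + (2 * i + 2 * i′) - 2 + 2 * b + (2 * i + 2 * i′) ∣
  ≡⟨ cong₂ ∣_-_∣ (trans (left a i i′) (cong (λ k → 2 * k + suc (2 * i′)) (m∸n+n≡m i≤K)))
                 (trans (right b i i′) (cong (λ k → 2 * k + (2 + 2 * i)) (m∸n+n≡m i′≤K))) ⟩
    ∣ 2 * K + suc (2 * i′) - 2 * K + (2 + 2 * i) ∣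
  ≡⟨ ∣m+n-m+o∣≡∣n-o∣ (2 * K) (suc (2 * i′)) (2 + 2 * i) ⟩
    ∣ 2 * i′ - suc (2 * i) ∣
  ≡⟨ ∣-∣-comm (2 * i′) (suc (2 * i)) ⟩
    ∣ suc (2 * i) - 2 * i′ ∣
  ∎
  where
  open ≡-Reasoning
  a b : ℕ
  a = K ∸ i
  b = K ∸ i′
  left : ∀ a i i′ → suc (2 * a) + (2 * i + 2 * i′) ≡ 2 * (a + i) + suc (2 * i′)
  left = solve-∀
  right : ∀ b i i′ → 2 + 2 * b + (2 * i + 2 * i′) ≡ 2 * (b + i′) + (2 + 2 * i)
  right = solve-∀

bottomGaps-reflect : ∀ K i is → i ≤ K → All (_≤ K) is →
  bottomGaps (suc (2 * (K ∸ i))) (map (shiftedDownPair ∘ (K ∸_)) is) ≡ bottomGaps (suc (2 * i)) (map upPair is)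
bottomGaps-reflect K i []        i≤K []             = refl
bottomGaps-reflect K i (i′ ∷ is) i≤K (i′≤K ∷ is≤K) =
  cong₂ _∷_ (∣odd-even∣-reflect i≤K i′≤K) (bottomGaps-reflect K i′ is i′≤K is≤K)

module OnesXY (α δ ε : ℕ) where
  β K x y ones : ℕ
  β    = δ + ε
  K    = α + β + δ
  x    = suc (2 * β)
  y    = 2 * suc K
  ones = suc (2 * (α + β))

  -- The zigzag alternates between the pair indices α + β + i and α + i, so each of its
  -- bottom junctions has length 2β + 1 = x; all other consecutive indices are adjacent.
  I′ : List ℕ
  I′ = interval 1 α ++ zigzag δ (suc (α + β)) (suc α) ++ interval (suc (α + δ)) ε

  I′-cover : 0 ∷ I′ ↭ interval 0 (suc K)
  I′-cover = begin
      interval 0 (suc α) ++ zigzag δ (suc (α + β)) (suc α) ++ interval (suc (α + δ)) ε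
    ↭⟨ ++⁺ˡ (interval 0 (suc α)) (++⁺ʳ (interval (suc (α + δ)) ε) (zigzag↭ δ (suc (α + β)) (suc α))) ⟩
      interval 0 (suc α) ++ (interval (suc α) δ ++ interval (suc (α + β)) δ) ++ interval (suc (α + δ)) ε
    ↭⟨ ++⁺ˡ (interval 0 (suc α)) (solve 3 (λ B U E → (B ⊕ U) ⊕ E ⊜ B ⊕ E ⊕ U) ↭-refl
                                         (interval (suc α) δ) (interval (suc (α + β)) δ) (interval (suc (α + δ)) ε)) ⟩
      interval 0 (suc α) ++ interval (suc α) δ ++ interval (suc (α + δ)) ε ++ interval (suc (α + β)) δ
    ≡⟨ cong (λ is → interval 0 (suc α) ++ interval (suc α) δ ++ is) (interval-join ε δ (cong suc (+-assoc α δ ε))) ⟩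
      interval 0 (suc α) ++ interval (suc α) δ ++ interval (suc (α + δ)) (ε + δ)
    ≡⟨ cong (interval 0 (suc α) ++_) (interval-join δ (ε + δ) refl) ⟩
      interval 0 (suc α) ++ interval (suc α) (δ + (ε + δ))
    ≡⟨ interval-join (suc α) (δ + (ε + δ)) refl ⟩
      interval 0 (suc α + (δ + (ε + δ)))
    ≡⟨ cong (interval 0) (size α δ ε) ⟩
      interval 0 (suc K)
    ∎
    where
    open PermutationReasoning
    open import Algebra.Solver.CommutativeMonoid (++-commutativeMonoid {A = ℕ})
    size : ∀ α δ ε → suc α + (δ + (ε + δ)) ≡ suc (α + (δ + ε) + δ)
    size = solve-∀

  length-I′ : length I′ ≡ K
  length-I′ = suc-injective (trans (↭-length I′-cover) (List.length-iterate suc 0 (suc K)))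

  I′-bounded : All (_≤ K) I′
  I′-bounded with All-resp-↭ (↭-sym I′-cover) (interval-bounded 0 (suc K))
  ... | _ ∷ I′<1+K = All.map ≤-pred I′<1+K

  bottomGaps-I′ : bottomGaps 1 (map upPair I′) ≡ replicate α 1 ++ replicate (2 * δ) x ++ replicate ε 1
  bottomGaps-I′ = begin
      bottomGaps 1 (map upPair I′)
    ≡⟨ cong (bottomGaps 1) (trans (List.map-++ upPair (interval 1 α) _)
                                  (cong (R₁ ++_) (List.map-++ upPair (zigzag δ (suc (α + β)) (suc α)) _))) ⟩
      bottomGaps 1 (R₁ ++ R₂ ++ R₃)
    ≡⟨ bottomGaps-++ 1 R₁ (R₂ ++ R₃) ⟩
      bottomGaps 1 R₁ ++ bottomGaps (lastResidue 1 R₁) (R₂ ++ R₃)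
    ≡⟨ cong₂ (λ gs v → gs ++ bottomGaps v (R₂ ++ R₃)) (bottomGaps-upRun 0 α) (lastResidue-upRun 0 α) ⟩
      replicate α 1 ++ bottomGaps (suc (2 * α)) (R₂ ++ R₃)
    ≡⟨ cong (replicate α 1 ++_) (bottomGaps-++ (suc (2 * α)) R₂ R₃) ⟩
      replicate α 1 ++ bottomGaps (suc (2 * α)) R₂ ++ bottomGaps (lastResidue (suc (2 * α)) R₂) R₃
    ≡⟨ cong₂ (λ gs v → replicate α 1 ++ gs ++ bottomGaps v R₃) (bottomGaps-zigzag β α δ) (lastResidue-zigzag β α δ) ⟩
      replicate α 1 ++ replicate (2 * δ) x ++ bottomGaps (suc (2 * (α + δ))) R₃
    ≡⟨ cong (λ gs → replicate α 1 ++ replicate (2 * δ) x ++ gs) (bottomGaps-upRun (α + δ) ε) ⟩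
      replicate α 1 ++ replicate (2 * δ) x ++ replicate ε 1
    ∎
    where
    open ≡-Reasoning
    R₁ R₂ R₃ : List (ℕ × ℕ)
    R₁ = map upPair (interval 1 α)
    R₂ = map upPair (zigzag δ (suc (α + β)) (suc α))
    R₃ = map upPair (interval (suc (α + δ)) ε)

  gaps : ∀ (f : ℕ → ℕ × ℕ) →
    bottomGaps 1 (map upPair I′) ++ replicate (suc (length (map f I′))) 1 ++ [] ↭ replicate ones 1 ++ replicate (2 * δ) x
  gaps f = begin
      bottomGaps 1 (map upPair I′) ++ replicate (suc (length (map f I′))) 1 ++ []
    ≡⟨ cong₂ (λ gs n → gs ++ replicate (suc n) 1 ++ []) bottomGaps-I′ (trans (List.length-map f I′) length-I′) ⟩
      (replicate α 1 ++ replicate (2 * δ) x ++ replicate ε 1) ++ replicate (suc K) 1 ++ []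
    ↭⟨ solve 4 (λ A D E O → (A ⊕ D ⊕ E) ⊕ O ⊕ id ⊜ (A ⊕ E ⊕ O) ⊕ D) ↭-refl
               (replicate α 1) (replicate (2 * δ) x) (replicate ε 1) (replicate (suc K) 1) ⟩
      (replicate α 1 ++ replicate ε 1 ++ replicate (suc K) 1) ++ replicate (2 * δ) x
    ≡⟨ cong (_++ replicate (2 * δ) x)
            (trans (replicate-+ α (ε + suc K) 1) (cong (replicate α 1 ++_) (replicate-+ ε (suc K) 1))) ⟨
      replicate (α + (ε + suc K)) 1 ++ replicate (2 * δ) x
    ≡⟨ cong (λ n → replicate n 1 ++ replicate (2 * δ) x) (count α δ ε) ⟩
      replicate ones 1 ++ replicate (2 * δ) x
    ∎
    where
    open PermutationReasoning
    open import Algebra.Solver.CommutativeMonoid (++-commutativeMonoid {A = ℕ})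
    count : ∀ α δ ε → α + (ε + suc (α + (δ + ε) + δ)) ≡ suc (2 * (α + (δ + ε)))
    count = solve-∀

  even-standard : ∀ q τ → 2 * τ < y → HasStandardLinearRealization (msetXY ones x (2 * δ) y (q * y + 2 * τ))
  even-standard q τ 2τ<y =
    standard-resp-↭ (↭-reflexive (List.++-assoc (replicate ones 1) _ _))
      (pairWalk-standard (<⇒≤ 2τ<y) 1 (map upPair I′) [] [] (q * y + 2 * τ) levels ↭-refl residues-cover (gaps upPair) refl)
    where
    open Chains y q (2 * τ)
    levels : All Level (map upPair (0 ∷ I′))
    levels = All.map⁺ (All.universal (λ i → level-up (2 * i) (λ 1+2i≡2τ → even≢odd τ i (sym 1+2i≡2τ))) (0 ∷ I′))
    residues-cover : residues (map upPair (0 ∷ I′)) ++ [] ↭ interval 0 y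
    residues-cover = ↭-trans (↭-reflexive (List.++-identityʳ _))
                             (↭-trans (residues-map-↭ upPair I′-cover) (↭-reflexive (residues-upRun 0 (suc K))))

  -- The even walk reflected through r ↦ y − r (mod y): its bottom junctions are unchanged, and
  -- since t is odd the two chains of each pair (2j + 2, 2j + 1) have the same height.
  odd-standard : ∀ q τ → suc (2 * τ) < y → HasStandardLinearRealization (msetXY ones x (2 * δ) y (q * y + suc (2 * τ)))
  odd-standard q τ t<y =
    standard-resp-↭ (↭-reflexive (List.++-assoc (replicate ones 1) _ _))
      (pairWalk-standard (<⇒≤ t<y) (suc (2 * K)) ps [] [] (q * y + suc (2 * τ)) levels ↭-refl residues-cover reflected-gaps refl)
    where
    open Chains y q (suc (2 * τ))
    ps : List (ℕ × ℕ)
    ps = map (shiftedDownPair ∘ (K ∸_)) I′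
    reflected-gaps : bottomGaps (suc (2 * K)) ps ++ replicate (suc (length ps)) 1 ++ [] ↭ replicate ones 1 ++ replicate (2 * δ) x
    reflected-gaps = ↭-trans (↭-reflexive (cong (_++ replicate (suc (length ps)) 1 ++ [])
                                                (bottomGaps-reflect K 0 I′ z≤n I′-bounded)))
                             (gaps (shiftedDownPair ∘ (K ∸_)))
    levels : All Level ((0 , suc (2 * K)) ∷ ps)
    levels = level-wrap (suc (2 * K)) (*-suc 2 K) (s≤s z≤n) (s≤s⁻¹ (subst (suc (2 * τ) <_) (*-suc 2 K) t<y))
           ∷ All.map⁺ (All.universal (λ i → level-down (suc (2 * (K ∸ i)))
                                                      (λ eq → even≢odd τ (K ∸ i) (sym (suc-injective eq)))) I′)
    reflected-cover : suc (2 * K) ∷ residues ps ↭ interval 1 (suc (2 * K))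
    reflected-cover = drop-∷ (begin
        2 + 2 * K ∷ suc (2 * K) ∷ residues ps
      ≡⟨ cong (λ rs → 2 + 2 * K ∷ suc (2 * K) ∷ rs) (cong residues (List.map-∘ I′)) ⟩
        residues (map shiftedDownPair (map (K ∸_) (0 ∷ I′)))
      ↭⟨ residues-map-↭ shiftedDownPair (↭-trans (map⁺ (K ∸_) I′-cover) (map-∸-interval K)) ⟩
        residues (map shiftedDownPair (interval 0 (suc K)))
      ↭⟨ residues-shiftedDownRun 0 (suc K) ⟩
        interval 1 (2 * suc K)
      ≡⟨ trans (cong (interval 1) (*-suc 2 K)) (interval-∷ʳ 1 (suc (2 * K))) ⟩
        interval 1 (suc (2 * K)) ∷ʳ (2 + 2 * K)
      ↭⟨ ∷↭∷ʳ (2 + 2 * K) (interval 1 (suc (2 * K))) ⟨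
        2 + 2 * K ∷ interval 1 (suc (2 * K))
      ∎)
      where open PermutationReasoning
    residues-cover : residues ((0 , suc (2 * K)) ∷ ps) ++ [] ↭ interval 0 y
    residues-cover = ↭-trans (↭-reflexive (List.++-identityʳ _))
                             (↭-trans (↭-prep 0 reflected-cover) (↭-reflexive (cong (interval 0) (sym (*-suc 2 K)))))

  standard : ∀ c → HasStandardLinearRealization (msetXY ones x (2 * δ) y c)
  standard = divMod-elim y (λ c → HasStandardLinearRealization (msetXY ones x (2 * δ) y c)) by-parity
    where
    by-parity : ∀ q t → t < y → HasStandardLinearRealization (msetXY ones x (2 * δ) y (q * y + t))
    by-parity q t t<y with even⊎odd t
    ... | τ , inj₁ refl = even-standard q τ t<y
    ... | τ , inj₂ refl = odd-standard q τ t<y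

standard-ones-x-y : ∀ α β δ c → δ ≤ β →
  HasStandardLinearRealization (msetXY (suc (2 * (α + β))) (suc (2 * β)) (2 * δ) (2 * suc (α + β + δ)) c)
standard-ones-x-y α β δ c δ≤β with m≤n⇒∃[o]m+o≡n {δ} {β} δ≤β
... | ε , refl = OnesXY.standard α δ ε c

module OnesX (β : ℕ) where
  b x : ℕ
  b = suc β
  x = suc (2 * b)

  ones-count : replicate β 1 ++ replicate (suc β) 1 ++ [ 1 ] ≡ replicate (2 * b) 1
  ones-count = begin
      replicate β 1 ++ replicate (suc β) 1 ++ replicate 1 1
    ≡⟨ cong (replicate β 1 ++_) (replicate-+ (suc β) 1 1) ⟨
      replicate β 1 ++ replicate (suc β + 1) 1
    ≡⟨ replicate-+ β (suc β + 1) 1 ⟨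
      replicate (β + (suc β + 1)) 1
    ≡⟨ cong (λ n → replicate n 1) (count β) ⟩
      replicate (2 * b) 1
    ∎
    where
    open ≡-Reasoning
    count : ∀ β → β + (suc β + 1) ≡ 2 * suc β
    count = solve-∀

  even-standard : ∀ q τ → 2 * τ < x → HasStandardLinearRealization (replicate (2 * b) 1 ++ replicate (q * x + 2 * τ) x)
  even-standard q τ 2τ<x =
    pairWalk-standard (<⇒≤ 2τ<x) 1 ps [ ascend (2 * b) ] [ 2 * b ] (q * x + 2 * τ) levels ↭-refl residues-cover gaps refl
    where
    open Chains x q (2 * τ)
    ps : List (ℕ × ℕ)
    ps = map upPair (interval 1 β)
    levels : All Level (map upPair (interval 0 b))
    levels = All.map⁺ (All.universal (λ i → level-up (2 * i) (λ 1+2i≡2τ → even≢odd τ i (sym 1+2i≡2τ))) (interval 0 b))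
    residues-cover : residues (map upPair (interval 0 b)) ++ [ 2 * b ] ↭ interval 0 x
    residues-cover = ↭-reflexive (trans (cong (_++ [ 2 * b ]) (residues-upRun 0 b)) (sym (interval-∷ʳ 0 (2 * b))))
    gaps : bottomGaps 1 ps ++ replicate (suc (length ps)) 1 ++ [ ∣ lastResidue 1 ps - 2 * b ∣ ] ↭ replicate (2 * b) 1
    gaps = ↭-reflexive (begin
        bottomGaps 1 ps ++ replicate (suc (length ps)) 1 ++ [ ∣ lastResidue 1 ps - 2 * b ∣ ]
      ≡⟨ cong₂ (λ gs v → gs ++ replicate (suc (length ps)) 1 ++ [ ∣ v - 2 * b ∣ ]) (bottomGaps-upRun 0 β) (lastResidue-upRun 0 β) ⟩
        replicate β 1 ++ replicate (suc (length ps)) 1 ++ [ ∣ suc (2 * β) - 2 * suc β ∣ ]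
      ≡⟨ cong₂ (λ n d → replicate β 1 ++ replicate (suc n) 1 ++ [ d ])
               (trans (List.length-map upPair (interval 1 β)) (List.length-iterate suc 1 β))
               (trans (cong (λ n → ∣ suc (2 * β) - n ∣) (*-suc 2 β)) (∣n-1+n∣≡1 (suc (2 * β)))) ⟩
        replicate β 1 ++ replicate (suc β) 1 ++ [ 1 ]
      ≡⟨ ones-count ⟩
        replicate (2 * b) 1
      ∎)
      where open ≡-Reasoning

  one-standard : ∀ q → HasStandardLinearRealization (replicate (2 * b) 1 ++ replicate (q * x + 1) x)
  one-standard q =
    pairWalk-standard (s≤s z≤n) (2 * b) ps [ ascend 1 ] [ 1 ] (q * x + 1) levels ↭-refl residues-cover gaps refl
    where
    open Chains x q 1
    ps : List (ℕ × ℕ)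
    ps = map downPair (applyDownFrom (1 +_) β)
    levels : All Level ((0 , 2 * b) ∷ ps)
    levels = level-wrap (2 * b) refl (s≤s z≤n) (s≤s z≤n)
           ∷ All.map⁺ (All.applyDownFrom⁺₂ (1 +_) β (λ i → level-down (2 * (1 + i)) (λ ())))
    residues-cover : residues ((0 , 2 * b) ∷ ps) ++ [ 1 ] ↭ interval 0 x
    residues-cover = ↭-prep 0 (begin
        2 * b ∷ residues ps ++ [ 1 ]
      ↭⟨ ↭-prep (2 * b) (++⁺ʳ [ 1 ] (residues-downRun 1 β)) ⟩
        2 * b ∷ interval 2 (2 * β) ++ [ 1 ]
      ↭⟨ solve 3 (λ B R O → B ⊕ R ⊕ O ⊜ O ⊕ R ⊕ B) ↭-refl [ 2 * b ] (interval 2 (2 * β)) [ 1 ] ⟩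
        1 ∷ interval 2 (2 * β) ∷ʳ 2 * b
      ≡⟨ cong (λ n → 1 ∷ interval 2 (2 * β) ∷ʳ n) (*-suc 2 β) ⟩
        1 ∷ interval 2 (2 * β) ∷ʳ (2 + 2 * β)
      ≡⟨ cong (1 ∷_) (interval-∷ʳ 2 (2 * β)) ⟨
        interval 1 (2 + 2 * β)
      ≡⟨ cong (interval 1) (*-suc 2 β) ⟨
        interval 1 (2 * b)
      ∎)
      where
      open PermutationReasoning
      open import Algebra.Solver.CommutativeMonoid (++-commutativeMonoid {A = ℕ})
    gaps : bottomGaps (2 * b) ps ++ replicate (suc (length ps)) 1 ++ [ ∣ lastResidue (2 * b) ps - 1 ∣ ] ↭ replicate (2 * b) 1
    gaps = ↭-reflexive (begin
        bottomGaps (2 * b) ps ++ replicate (suc (length ps)) 1 ++ [ ∣ lastResidue (2 * b) ps - 1 ∣ ]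
      ≡⟨ cong₂ (λ gs v → gs ++ replicate (suc (length ps)) 1 ++ [ ∣ v - 1 ∣ ]) (bottomGaps-downRun 1 β) (lastResidue-downRun 1 β) ⟩
        replicate β 1 ++ replicate (suc (length ps)) 1 ++ [ 1 ]
      ≡⟨ cong (λ n → replicate β 1 ++ replicate (suc n) 1 ++ [ 1 ])
              (trans (List.length-map downPair (applyDownFrom (1 +_) β)) (List.length-applyDownFrom (1 +_) β)) ⟩
        replicate β 1 ++ replicate (suc β) 1 ++ [ 1 ]
      ≡⟨ ones-count ⟩
        replicate (2 * b) 1
      ∎)
      where open ≡-Reasoning

-- On (q + 1) x + t + 1 vertices a pair walk would have q x + t + 1 edges x and x − 1 edges 1.
-- Here chain 2 is walked without its top, which is visited between the tops of chains 3 and 1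
-- instead; this trades one edge x for an edge 1.
module OnesXGadget (β q τ : ℕ) (t<x : suc (2 * suc τ) < suc (2 * (2 + β))) where
  b x σ : ℕ
  b = 2 + β
  x = suc (2 * b)
  σ = 2 + τ

  open Walks x
  open Chains x q (2 * σ)

  gadget : List Segment
  gadget = ascend 3 ∷ up (top 2) 0 ∷ descend 1 ∷ up 2 q ∷ []

  ps : List (ℕ × ℕ)
  ps = map downPair (applyDownFrom (2 +_) β)

  2σ≤2b : 2 * σ ≤ 2 * b
  2σ≤2b = subst (_≤ 2 * b) (sym (*-suc 2 (suc τ)))
                (≤∧≢⇒< (s≤s⁻¹ t<x) (λ eq → even≢odd b (suc τ) (sym eq)))

  2σ≤x : 2 * σ ≤ x
  2σ≤x = m≤n⇒m≤1+n 2σ≤2b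

  2<2σ : 2 < 2 * σ
  2<2σ = ≤-trans (s≤s (s≤s (s≤s z≤n))) (*-monoʳ-≤ 2 (s≤s (s≤s (z≤n {τ}))))

  levels : All Level ((0 , 2 * b) ∷ ps)
  levels = level-wrap (2 * b) refl (≤-trans (s≤s z≤n) 2<2σ) 2σ≤2b
         ∷ All.map⁺ (All.applyDownFrom⁺₂ (2 +_) β (λ i → level-down (2 * (2 + i)) (λ eq → even≢odd σ (2 + i) (sym eq))))

  chain₂ : chain 2 ≡ progression 2 q ∷ʳ top 2
  chain₂ rewrite height-< 2<2σ = progression-∷ʳ 2 q

  gadget-cover : walk gadget ↭ concatMap chain (3 ∷ 2 ∷ 1 ∷ [])
  gadget-cover = ++⁺ˡ (chain 3) (begin
      top 2 ∷ reverse (chain 1) ++ progression 2 q ++ []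
    ↭⟨ solve 3 (λ T R P → T ⊕ R ⊕ P ⊕ id ⊜ (P ⊕ T) ⊕ R ⊕ id) ↭-refl [ top 2 ] (reverse (chain 1)) (progression 2 q) ⟩
      (progression 2 q ∷ʳ top 2) ++ reverse (chain 1) ++ []
    ≡⟨ cong (_++ reverse (chain 1) ++ []) chain₂ ⟨
      chain 2 ++ reverse (chain 1) ++ []
    ↭⟨ ++⁺ˡ (chain 2) (++⁺ʳ [] (↭-reverse (chain 1))) ⟩
      chain 2 ++ chain 1 ++ []
    ∎)
    where
    open PermutationReasoning
    open import Algebra.Solver.CommutativeMonoid (++-commutativeMonoid {A = ℕ})

  residues-cover : residues ((0 , 2 * b) ∷ ps) ++ 3 ∷ 2 ∷ 1 ∷ [] ↭ interval 0 x
  residues-cover = ↭-prep 0 (begin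
      2 * b ∷ residues ps ++ 3 ∷ 2 ∷ 1 ∷ []
    ↭⟨ ↭-prep (2 * b) (++⁺ʳ (3 ∷ 2 ∷ 1 ∷ []) (residues-downRun 2 β)) ⟩
      2 * b ∷ interval 4 (2 * β) ++ 3 ∷ 2 ∷ 1 ∷ []
    ↭⟨ solve 5 (λ B R T U V → B ⊕ R ⊕ T ⊕ U ⊕ V ⊜ V ⊕ U ⊕ T ⊕ R ⊕ B) ↭-refl
             [ 2 * b ] (interval 4 (2 * β)) [ 3 ] [ 2 ] [ 1 ] ⟩
      1 ∷ 2 ∷ 3 ∷ interval 4 (2 * β) ∷ʳ 2 * b
    ≡⟨ cong (λ n → 1 ∷ 2 ∷ 3 ∷ interval 4 (2 * β) ∷ʳ n) (double β) ⟩
      1 ∷ 2 ∷ 3 ∷ interval 4 (2 * β) ∷ʳ (4 + 2 * β)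
    ≡⟨ cong (λ is → 1 ∷ 2 ∷ 3 ∷ is) (interval-∷ʳ 4 (2 * β)) ⟨
      interval 1 (4 + 2 * β)
    ≡⟨ cong (interval 1) (double β) ⟨
      interval 1 (2 * b)
    ∎)
    where
    open PermutationReasoning
    open import Algebra.Solver.CommutativeMonoid (++-commutativeMonoid {A = ℕ})
    double : ∀ β → 2 * (2 + β) ≡ 4 + 2 * β
    double = solve-∀

  gaps : bottomGaps (2 * b) ps ++ replicate (suc (length ps)) 1 ++ junctionsFrom (lastResidue (2 * b) ps) gadget ↭ replicate x 1
  gaps = ↭-reflexive (begin
      bottomGaps (2 * b) ps ++ replicate (suc (length ps)) 1 ++ junctionsFrom (lastResidue (2 * b) ps) gadget
    ≡⟨ cong₂ _++_ (bottomGaps-downRun 2 β)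
                  (cong₂ (λ n v → replicate (suc n) 1 ++ junctionsFrom v gadget)
                         (trans (List.length-map downPair (applyDownFrom (2 +_) β)) (List.length-applyDownFrom (2 +_) β))
                         (lastResidue-downRun 2 β)) ⟩
      replicate β 1 ++ replicate (suc β) 1 ++ 1 ∷ ∣ top 3 - top 2 ∣ ∷ ∣ top 2 + 0 - top 1 ∣ ∷ 1 ∷ []
    ≡⟨ cong₂ (λ d d′ → replicate β 1 ++ replicate (suc β) 1 ++ 1 ∷ d ∷ d′ ∷ 1 ∷ [])
             (level-down 2 (λ eq → even≢odd σ 1 (sym eq)))
             (trans (cong (λ v → ∣ v - top 1 ∣) (+-identityʳ (top 2))) (level-down 1 (<⇒≢ 2<2σ))) ⟩
      replicate β 1 ++ replicate (suc β) 1 ++ replicate 4 1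
    ≡⟨ cong (replicate β 1 ++_) (replicate-+ (suc β) 4 1) ⟨
      replicate β 1 ++ replicate (suc β + 4) 1
    ≡⟨ replicate-+ β (suc β + 4) 1 ⟨
      replicate (β + (suc β + 4)) 1
    ≡⟨ cong (λ n → replicate n 1) (ones β) ⟩
      replicate x 1
    ∎)
    where
    open ≡-Reasoning
    ones : ∀ β → β + (suc β + 4) ≡ suc (2 * (2 + β))
    ones = solve-∀

  count : ∀ Q τ → Q + suc (2 * suc τ) + 4 ≡ Q + 2 * (2 + τ) + 3
  count = solve-∀

  standard : HasStandardLinearRealization (replicate x 1 ++ replicate (q * x + suc (2 * suc τ)) x)
  standard = pairWalk-standard 2σ≤x (2 * b) ps gadget (3 ∷ 2 ∷ 1 ∷ []) (q * x + suc (2 * suc τ))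
                               levels gadget-cover residues-cover gaps (count (q * x) τ)

gadget-standard : ∀ β q τ → suc (2 * suc τ) < suc (2 * suc β) →
  HasStandardLinearRealization
    (replicate (suc (2 * suc β)) 1 ++ replicate (q * suc (2 * suc β) + suc (2 * suc τ)) (suc (2 * suc β)))
gadget-standard zero     q τ t<3 = contradiction (s≤s (*-monoʳ-≤ 2 (s≤s (z≤n {τ})))) (<⇒≱ t<3)
gadget-standard (suc β) q τ t<x = OnesXGadget.standard β q τ t<x

standard-[] : HasStandardLinearRealization []
standard-[] = 0 ∷ [] , [] , refl , ↭-refl , ↭-refl

standard-ones-x : ∀ β m → HasStandardLinearRealization (replicate (suc (2 * β)) 1 ++ replicate m (suc (2 * β)))
standard-ones-x zero    m =
  subst HasStandardLinearRealization (List.++-identityʳ (replicate (suc m) 1)) (standard-ones-++ (suc m) standard-[])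
standard-ones-x (suc β) = divMod-elim x (λ m → HasStandardLinearRealization (replicate x 1 ++ replicate m x)) by-residue
  where
  x : ℕ
  x = suc (2 * suc β)
  by-residue : ∀ q t → t < x → HasStandardLinearRealization (replicate x 1 ++ replicate (q * x + t) x)
  by-residue q t t<x with even⊎odd t
  ... | τ , inj₁ refl     = standard-∷-1 (OnesX.even-standard β q τ t<x)
  ... | zero , inj₂ refl  = standard-∷-1 (OnesX.one-standard β q)
  ... | suc τ , inj₂ refl = gadget-standard β q τ t<x

msetXY-cong : ∀ {a a′ x x′ y y′} b c → a ≡ a′ → x ≡ x′ → y ≡ y′ → msetXY a x b y c ≡ msetXY a′ x′ b y′ c
msetXY-cong b c refl refl refl = refl

theorem3p7-shape : ∀ j k → 2 * k ≤ 2 * (2 * j + 1) → 2 * j + 1 < 2 * k ∸ 1 → ∃ λ e → k ≡ suc (j + e) × e ≤ j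
theorem3p7-shape j k y≤2x x<y-1
  with m≤n⇒∃[o]m+o≡n {suc j} {k}
         (*-cancelˡ-< 2 j k (<-trans (m<m+n (2 * j) (s≤s z≤n)) (<-≤-trans x<y-1 (m∸n≤m (2 * k) 1))))
... | e , refl = e , refl , +-cancelˡ-≤ (suc j) e j (subst (suc j + e ≤_) (odd j) (*-cancelˡ-≤ 2 y≤2x))
  where
  odd : ∀ j → 2 * j + 1 ≡ suc j + j
  odd = solve-∀

y∸x∸1≡2*e : ∀ j e → 2 * suc (j + e) ∸ (2 * j + 1) ∸ 1 ≡ 2 * e
y∸x∸1≡2*e j e = trans (∸-+-assoc (2 * suc (j + e)) (2 * j + 1) 1)
                  (trans (cong (_∸ (2 * j + 1 + 1)) (split j e)) (m+n∸m≡n (2 * j + 1 + 1) (2 * e)))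
  where
  split : ∀ j e → 2 * suc (j + e) ≡ 2 * j + 1 + 1 + 2 * e
  split = solve-∀

theorem3p7-standard : ∀ j e → e ≤ j → (d c : ℕ) → ∃ (λ k → d ≡ 2 * k) → d ≤ 2 * suc (j + e) ∸ (2 * j + 1) ∸ 1 →
  HasStandardLinearRealization (msetXY (2 * suc (j + e) ∸ 1 ∸ d) (2 * j + 1) d (2 * suc (j + e)) c)
theorem3p7-standard j e e≤j .(2 * δ) c (δ , refl) d≤y-x-1
  with m≤n⇒∃[o]m+o≡n {δ} {e} (*-cancelˡ-≤ 2 (subst (2 * δ ≤_) (y∸x∸1≡2*e j e) d≤y-x-1))
... | α , refl =
  subst HasStandardLinearRealization (msetXY-cong (2 * δ) c (sym ones) (+-comm 1 (2 * j)) (cong (2 *_) (cong suc (shuffle α j δ))))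
        (standard-ones-x-y α j δ c (≤-trans (m≤m+n δ α) e≤j))
  where
  shuffle : ∀ α j δ → α + j + δ ≡ j + (δ + α)
  shuffle = solve-∀
  split : ∀ α j δ → 2 * suc (j + (δ + α)) ≡ suc (2 * δ + suc (2 * (α + j)))
  split = solve-∀
  ones : 2 * suc (j + (δ + α)) ∸ 1 ∸ 2 * δ ≡ suc (2 * (α + j))
  ones = trans (cong (λ n → n ∸ 1 ∸ 2 * δ) (split α j δ)) (m+n∸m≡n (2 * δ) (suc (2 * (α + j))))

theorem3p7-linear : ∀ j e → e ≤ j → (a b c : ℕ) → 2 * (2 * j + 1) ≤ a → 2 * suc (j + e) ∸ (2 * j + 1) ∸ 1 ≤ b →
  HasLinearRealization (msetXY a (2 * j + 1) b (2 * suc (j + e)) c)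
theorem3p7-linear j e e≤j a b c 2x≤a y-x-1≤b =
  subst (λ x → HasLinearRealization (msetXY a x b (2 * suc (j + e)) c)) (+-comm 1 (2 * j))
    (linear-resp-↭ merge (linear-++ (standard-ones-x-y 0 j e c e≤j) (standard-ones-++ n (standard-ones-x j m))))
  where
  x y : ℕ
  x = suc (2 * j)
  y = 2 * suc (j + e)
  2e≤b : 2 * e ≤ b
  2e≤b = subst (_≤ b) (y∸x∸1≡2*e j e) y-x-1≤b
  2x≤a′ : x + x ≤ a
  2x≤a′ = subst (_≤ a) (trans (cong (2 *_) (+-comm (2 * j) 1)) (cong (x +_) (+-identityʳ x))) 2x≤a
  n m : ℕ
  n = a ∸ (x + x)
  m = b ∸ 2 * e
  merge : msetXY x x (2 * e) y c ++ replicate n 1 ++ replicate x 1 ++ replicate m x ↭ msetXY a x b y c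
  merge = begin
      (replicate x 1 ++ replicate (2 * e) x ++ replicate c y) ++ replicate n 1 ++ replicate x 1 ++ replicate m x
    ↭⟨ solve 5 (λ X E C N M → (X ⊕ E ⊕ C) ⊕ N ⊕ X ⊕ M ⊜ (N ⊕ X ⊕ X) ⊕ (E ⊕ M) ⊕ C) ↭-refl
             (replicate x 1) (replicate (2 * e) x) (replicate c y) (replicate n 1) (replicate m x) ⟩
      (replicate n 1 ++ replicate x 1 ++ replicate x 1) ++ (replicate (2 * e) x ++ replicate m x) ++ replicate c y
    ≡⟨ cong₂ (λ os xs → os ++ xs ++ replicate c y)
             (trans (replicate-+ n (x + x) 1) (cong (replicate n 1 ++_) (replicate-+ x x 1)))
             (replicate-+ (2 * e) m x) ⟨
      replicate (n + (x + x)) 1 ++ replicate (2 * e + m) x ++ replicate c y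
    ≡⟨ cong₂ (λ k l → replicate k 1 ++ replicate l x ++ replicate c y) (m∸n+n≡m 2x≤a′) (m+[n∸m]≡n 2e≤b) ⟩
      msetXY a x b y c
    ∎
    where
    open PermutationReasoning
    open import Algebra.Solver.CommutativeMonoid (++-commutativeMonoid {A = ℕ})

theorem3p7 : (x y : ℕ) → ∃ (λ k → y ≡ 2 * k) → ∃ (λ k → x ≡ 2 * k + 1) →
    y ≤ 2 * x → x < y ∸ 1 →
    ((d c : ℕ) → ∃ (λ k → d ≡ 2 * k) → d ≤ y ∸ x ∸ 1 →
      HasStandardLinearRealization (msetXY (y ∸ 1 ∸ d) x d y c))
    × ((a b c : ℕ) → 2 * x ≤ a → y ∸ x ∸ 1 ≤ b → HasLinearRealization (msetXY a x b y c))
theorem3p7 _ _ (k , refl) (j , refl) y≤2x x<y-1 with theorem3p7-shape j k y≤2x x<y-1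
... | e , refl , e≤j = theorem3p7-standard j e e≤j , theorem3p7-linear j e e≤j
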